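{- Let $G$ be a chordal graph, $T\subseteq V(G)$, and let $S$ be an inclusion-minimal set of vertices such that $G-S$ contains no $T$-cycle. Let $v\in S\setminus T$ be a vertex for which there exists a clique $Q$ in $G$ such that every $T$-triangle containing $v$ is contained in $Q$. Then there is a unique $T$-triangle $\triangle_v$ such that $v$ is the only vertex of $S$ in $\triangle_v$.
   Context: A graph is chordal if every cycle of length at least four has a chord. A $T$-cycle ($T$-triangle) is a cycle (triangle) containing at least one vertex of $T$. -}

module Defs where

open import Data.Nat using (ℕ; zero; suc; _≤_)
open import Data.Fin using (Fin; toℕ)
open import Data.Fin.Subset using (Subset; _∈_; _∉_; _⊆_; _⊂_; ∣_∣)
open import Data.Product using (Σ; ∃; ∃-syntax; _×_; _,_)
open import Data.Sum using (_⊎_)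
open import Relation.Nullary using (¬_; Dec)
open import Relation.Binary.PropositionalEquality using (_≡_; _≢_)
open import Function.Definitions using (Injective)

record Graph (n : ℕ) : Set₁ where
  field
    Adj     : Fin n → Fin n → Set
    adj-sym : ∀ {x y} → Adj x y → Adj y x
    adj-irr : ∀ {x} → ¬ Adj x x
    adj-dec : ∀ x y → Dec (Adj x y)
open Graph public

Consecutive : (k : ℕ) → Fin k → Fin k → Set
Consecutive k i j = (suc (toℕ i) ≡ toℕ j) ⊎ (suc (toℕ i) ≡ k × toℕ j ≡ 0)

record Cycle {n : ℕ} (G : Graph n) : Set where
  field
    len      : ℕ
    len≥3    : 3 ≤ len
    vert     : Fin len → Fin n
    distinct : Injective _≡_ _≡_ vert
    edges    : ∀ i j → Consecutive len i j → Adj G (vert i) (vert j)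
open Cycle public

HasChord : ∀ {n} {G : Graph n} → Cycle G → Set
HasChord {G = G} C =
  ∃[ i ] ∃[ j ] (i ≢ j × ¬ Consecutive (len C) i j × ¬ Consecutive (len C) j i
                × Adj G (vert C i) (vert C j))

Chordal : ∀ {n} → Graph n → Set
Chordal G = (C : Cycle G) → 4 ≤ len C → HasChord C

TCycleAvoiding : ∀ {n} (G : Graph n) (T S : Subset n) → Cycle G → Set
TCycleAvoiding G T S C = (∀ i → vert C i ∉ S) × (∃[ i ] vert C i ∈ T)

NoTCycleAfterDeleting : ∀ {n} (G : Graph n) (T S : Subset n) → Set
NoTCycleAfterDeleting G T S = (C : Cycle G) → ¬ TCycleAvoiding G T S C

MinimalTCycleHittingSet : ∀ {n} (G : Graph n) (T S : Subset n) → Set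
MinimalTCycleHittingSet G T S =
  NoTCycleAfterDeleting G T S × (∀ S′ → S′ ⊂ S → ¬ NoTCycleAfterDeleting G T S′)

Clique : ∀ {n} (G : Graph n) → Subset n → Set
Clique G Q = ∀ x y → x ∈ Q → y ∈ Q → x ≢ y → Adj G x y

Triangle : ∀ {n} (G : Graph n) → Subset n → Set
Triangle G Δ = ∣ Δ ∣ ≡ 3 × Clique G Δ

TTriangle : ∀ {n} (G : Graph n) (T : Subset n) → Subset n → Set
TTriangle G T Δ = Triangle G Δ × (∃[ t ] (t ∈ Δ × t ∈ T))

module Submission where

-- In a chordal graph every vertex t of a cycle lies in a triangle spanned by vertices of the
-- cycle: a chord splits the cycle into two shorter cycles, one of which still passes through t.
-- By minimality of S, G − (S − v) contains a T-cycle and hence a T-triangle; since G − S has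
-- none, this triangle is {v, b, c} with b, c ∉ S. Another T-triangle through v meeting S only in
-- v lies with {v, b, c} in the clique Q, so any vertex x of it outside {v, b, c} would make
-- {x, b, c} a T-triangle avoiding S. Hence it is contained in {v, b, c}, and both have size 3.

open import Defs
open import Data.Nat using (ℕ; zero; suc; _+_; _≤_; _<_; _≤?_; z≤n; s≤s)
open import Data.Nat.Properties
open import Data.Nat.DivMod using (_mod_; m<n⇒m%n≡m)
open import Data.Nat.Induction using (<-rec)
open import Data.Nat.Tactic.RingSolver using (solve-∀)
open import Data.Fin using (Fin; toℕ) renaming (zero to 0F; suc to 1+)
import Data.Fin.Properties as Fin
open import Data.Fin.Subset using (Subset; _∈_; _∉_; _⊆_; ∣_∣; ⁅_⁆; _∪_; _-_; outside; inside)
open import Data.Fin.Subset.Properties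
  using (_∈?_; ∪-identityˡ; x∈⁅x⁆; x∈⁅y⁆⇒x≡y; x≢y⇒x∉⁅y⁆; ∣⁅x⁆∣≡1; x∈p∪q⁺; x∈p∪q⁻;
         ⊆-antisym; p⊂q⇒∣p∣<∣q∣; x∈p∧x≢y⇒x∈p-y; x∈p⇒p-x⊂p)
open import Data.Vec using (_∷_; here; there)
open import Data.Product using (∃₂; ∃-syntax; _×_; _,_; proj₁)
open import Data.Sum using (_⊎_; inj₁; inj₂; [_,_]′)
open import Data.Empty using (⊥; ⊥-elim)
open import Function using (_∘_)
open import Function.Definitions using (Injective)
open import Relation.Nullary using (¬_; Dec; yes; no; contradiction)
open import Relation.Nullary.Decidable using (_×-dec_; _⊎-dec_; ¬?; decidable-stable)
open import Relation.Binary.Definitions using (tri<; tri≈; tri>)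
open import Relation.Binary.PropositionalEquality

stepwise-increasing : ∀ {m} (φ : ℕ → ℕ) → (∀ {a} → a < m → φ a < φ (suc a)) →
                      ∀ {a b} → a < b → b ≤ m → φ a < φ b
stepwise-increasing φ inc {a} {suc b} a<1+b 1+b≤m with m<1+n⇒m<n∨m≡n a<1+b
... | inj₂ refl = inc 1+b≤m
... | inj₁ a<b  = <-trans (stepwise-increasing φ inc a<b (<⇒≤ 1+b≤m)) (inc 1+b≤m)

stepwise-monotone : ∀ {m} (φ : ℕ → ℕ) → (∀ {a} → a < m → φ a < φ (suc a)) →
                    ∀ {a b} → a ≤ b → b ≤ m → φ a ≤ φ b
stepwise-monotone φ inc a≤b b≤m with m≤n⇒m<n∨m≡n a≤b
... | inj₁ a<b  = <⇒≤ (stepwise-increasing φ inc a<b b≤m)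
... | inj₂ refl = ≤-refl

stepwise-injective : ∀ {m} (φ : ℕ → ℕ) → (∀ {a} → a < m → φ a < φ (suc a)) →
                     ∀ {a b} → a ≤ m → b ≤ m → φ a ≡ φ b → a ≡ b
stepwise-injective φ inc {a} {b} a≤m b≤m φa≡φb with <-cmp a b
... | tri< a<b _ _ = contradiction φa≡φb (<⇒≢ (stepwise-increasing φ inc a<b b≤m))
... | tri≈ _ a≡b _ = a≡b
... | tri> _ _ b<a = contradiction (sym φa≡φb) (<⇒≢ (stepwise-increasing φ inc b<a a≤m))

-- Deletes the positions x+1, …, x+k.
skipAfter : ℕ → ℕ → ℕ → ℕ
skipAfter x k a with a ≤? x
... | yes _ = a
... | no  _ = a + k

skipAfter-≤ : ∀ {x a} k → a ≤ x → skipAfter x k a ≡ a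
skipAfter-≤ {x} {a} k a≤x with a ≤? x
... | yes _   = refl
... | no  a≰x = contradiction a≤x a≰x

skipAfter-> : ∀ {x a} k → x < a → skipAfter x k a ≡ a + k
skipAfter-> {x} {a} k x<a with a ≤? x
... | yes a≤x = contradiction a≤x (<⇒≱ x<a)
... | no  _   = refl

skipAfter≤+ : ∀ x k a → skipAfter x k a ≤ a + k
skipAfter≤+ x k a with a ≤? x
... | yes _ = m≤m+n a k
... | no  _ = ≤-refl

skipAfter-suc : ∀ {x a} k → a ≢ x → skipAfter x k (suc a) ≡ suc (skipAfter x k a)
skipAfter-suc {x} {a} k a≢x with <-cmp a x
... | tri< a<x _ _ = trans (skipAfter-≤ k a<x) (cong suc (sym (skipAfter-≤ k (<⇒≤ a<x))))
... | tri≈ _ a≡x _ = contradiction a≡x a≢x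
... | tri> _ _ x<a = trans (skipAfter-> k (m<n⇒m<1+n x<a)) (cong suc (sym (skipAfter-> k x<a)))

toℕ-mod : ∀ {a m} → a ≤ m → toℕ (a mod suc m) ≡ a
toℕ-mod a≤m = trans (Fin.toℕ-fromℕ< _) (m<n⇒m%n≡m (s≤s a≤m))

[2+d]+[x+e]≡[2+x+d]+e : ∀ x d e → suc (suc d) + (x + e) ≡ suc (suc (x + d)) + e
[2+d]+[x+e]≡[2+x+d]+e = solve-∀

[1+x+r]+[1+d]≡[2+x+d]+r : ∀ x d r → suc (x + r) + suc d ≡ suc (suc (x + d)) + r
[1+x+r]+[1+d]≡[2+x+d]+r = solve-∀

0<x+e : ∀ x e {y} → ¬ (x ≡ 0 × y ≡ y + e) → 0 < x + e
0<x+e (suc x) e       _           = s≤s z≤n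
0<x+e zero    (suc e) _           = s≤s z≤n
0<x+e zero    zero    not-closing = contradiction (refl , sym (+-identityʳ _)) not-closing

⁅_⨾_⨾_⁆ : ∀ {n} → Fin n → Fin n → Fin n → Subset n
⁅ x ⨾ y ⨾ z ⁆ = ⁅ x ⁆ ∪ ⁅ y ⁆ ∪ ⁅ z ⁆

module _ {n} {x y z : Fin n} where

  x∈⁅x⨾y⨾z⁆ : x ∈ ⁅ x ⨾ y ⨾ z ⁆
  x∈⁅x⨾y⨾z⁆ = x∈p∪q⁺ (inj₁ (x∈⁅x⁆ x))

  y∈⁅x⨾y⨾z⁆ : y ∈ ⁅ x ⨾ y ⨾ z ⁆
  y∈⁅x⨾y⨾z⁆ = x∈p∪q⁺ (inj₂ (x∈p∪q⁺ (inj₁ (x∈⁅x⁆ y))))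

  z∈⁅x⨾y⨾z⁆ : z ∈ ⁅ x ⨾ y ⨾ z ⁆
  z∈⁅x⨾y⨾z⁆ = x∈p∪q⁺ (inj₂ (x∈p∪q⁺ (inj₂ (x∈⁅x⁆ z))))

  ∈⁅x⨾y⨾z⁆⁻ : ∀ {u} → u ∈ ⁅ x ⨾ y ⨾ z ⁆ → u ≡ x ⊎ u ≡ y ⊎ u ≡ z
  ∈⁅x⨾y⨾z⁆⁻ u∈ with x∈p∪q⁻ ⁅ x ⁆ _ u∈
  ... | inj₁ u∈x = inj₁ (x∈⁅y⁆⇒x≡y x u∈x)
  ... | inj₂ u∈yz with x∈p∪q⁻ ⁅ y ⁆ ⁅ z ⁆ u∈yz
  ...   | inj₁ u∈y = inj₂ (inj₁ (x∈⁅y⁆⇒x≡y y u∈y))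
  ...   | inj₂ u∈z = inj₂ (inj₂ (x∈⁅y⁆⇒x≡y z u∈z))

∣⁅x⁆∪p∣≡1+∣p∣ : ∀ {n} {x : Fin n} {p : Subset n} → x ∉ p → ∣ ⁅ x ⁆ ∪ p ∣ ≡ suc ∣ p ∣
∣⁅x⁆∪p∣≡1+∣p∣ {x = 0F}   {outside ∷ p} _   = cong (suc ∘ ∣_∣) (∪-identityˡ p)
∣⁅x⁆∪p∣≡1+∣p∣ {x = 0F}   {inside  ∷ p} x∉p = contradiction here x∉p
∣⁅x⁆∪p∣≡1+∣p∣ {x = 1+ x} {outside ∷ p} x∉p = ∣⁅x⁆∪p∣≡1+∣p∣ (x∉p ∘ there)
∣⁅x⁆∪p∣≡1+∣p∣ {x = 1+ x} {inside  ∷ p} x∉p = cong suc (∣⁅x⁆∪p∣≡1+∣p∣ (x∉p ∘ there))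

∣⁅x⨾y⨾z⁆∣≡3 : ∀ {n} {x y z : Fin n} → x ≢ y → x ≢ z → y ≢ z → ∣ ⁅ x ⨾ y ⨾ z ⁆ ∣ ≡ 3
∣⁅x⨾y⨾z⁆∣≡3 {x = x} {y} {z} x≢y x≢z y≢z = begin
  ∣ ⁅ x ⁆ ∪ ⁅ y ⁆ ∪ ⁅ z ⁆ ∣ ≡⟨ ∣⁅x⁆∪p∣≡1+∣p∣ x∉yz ⟩
  suc ∣ ⁅ y ⁆ ∪ ⁅ z ⁆ ∣     ≡⟨ cong suc (∣⁅x⁆∪p∣≡1+∣p∣ (x≢y⇒x∉⁅y⁆ y≢z)) ⟩
  suc (suc ∣ ⁅ z ⁆ ∣)       ≡⟨ cong (suc ∘ suc) (∣⁅x⁆∣≡1 z) ⟩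
  3                         ∎
  where
  open ≡-Reasoning
  x∉yz : x ∉ ⁅ y ⁆ ∪ ⁅ z ⁆
  x∉yz x∈yz with x∈p∪q⁻ ⁅ y ⁆ ⁅ z ⁆ x∈yz
  ... | inj₁ x∈y = x≢y (x∈⁅y⁆⇒x≡y y x∈y)
  ... | inj₂ x∈z = x≢z (x∈⁅y⁆⇒x≡y z x∈z)

p⊆q∧∣q∣≤∣p∣⇒p≡q : ∀ {n} {p q : Subset n} → p ⊆ q → ∣ q ∣ ≤ ∣ p ∣ → p ≡ q
p⊆q∧∣q∣≤∣p∣⇒p≡q {p = p} {q} p⊆q ∣q∣≤∣p∣ = ⊆-antisym p⊆q q⊆p
  where
  q⊆p : q ⊆ p
  q⊆p {x} x∈q with x ∈? p
  ... | yes x∈p = x∈p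
  ... | no  x∉p = contradiction (p⊂q⇒∣p∣<∣q∣ (p⊆q , x , x∈q , x∉p)) (≤⇒≯ ∣q∣≤∣p∣)

module _ {n} (G : Graph n) where

  IsTriangle : Fin n → Fin n → Fin n → Set
  IsTriangle a b c = Adj G a b × Adj G b c × Adj G c a

  rotate : ∀ {a b c} → IsTriangle a b c → IsTriangle b c a
  rotate (ab , bc , ca) = bc , ca , ab

  adj⇒≢ : ∀ {a b} → Adj G a b → a ≢ b
  adj⇒≢ ab refl = adj-irr G ab

  -- A cycle through the positions 0, …, m; `at` is irrelevant beyond m.
  record IndexedCycle (m : ℕ) : Set where
    field
      at           : ℕ → Fin n
      long         : 2 ≤ m
      at-injective : ∀ {a b} → a ≤ m → b ≤ m → at a ≡ at b → a ≡ b
      step         : ∀ {a} → a < m → Adj G (at a) (at (suc a))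
      close        : Adj G (at m) (at 0)
  open IndexedCycle

  toCycle : ∀ {m} → IndexedCycle m → Cycle G
  toCycle {m} c = record
    { len      = suc m
    ; len≥3    = s≤s (long c)
    ; vert     = at c ∘ toℕ
    ; distinct = λ {i} {j} → Fin.toℕ-injective ∘
                   at-injective c (Fin.toℕ≤pred[n] i) (Fin.toℕ≤pred[n] j)
    ; edges    = consecutive-adjacent
    }
    where
    consecutive-adjacent : ∀ i j → Consecutive (suc m) i j → Adj G (at c (toℕ i)) (at c (toℕ j))
    consecutive-adjacent i j (inj₁ i+1≡j) =
      subst (Adj G (at c (toℕ i)) ∘ at c) i+1≡j
        (step c (subst (_≤ m) (sym i+1≡j) (Fin.toℕ≤pred[n] j)))
    consecutive-adjacent i j (inj₂ (i+1≡1+m , j≡0)) =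
      subst₂ (λ a b → Adj G (at c a) (at c b)) (sym (suc-injective i+1≡1+m)) (sym j≡0) (close c)

  record Chord {m} (c : IndexedCycle m) : Set where
    constructor chord
    field
      {x y}       : ℕ
      gap         : suc x < y
      y≤m         : y ≤ m
      not-closing : ¬ (x ≡ 0 × y ≡ m)
      adjacent    : Adj G (at c x) (at c y)

  chord-between : ∀ {m} (c : IndexedCycle m) (i j : Fin (suc m)) → toℕ i < toℕ j →
                  ¬ Consecutive (suc m) i j → ¬ Consecutive (suc m) j i →
                  Adj G (at c (toℕ i)) (at c (toℕ j)) → Chord c
  chord-between c i j i<j ¬i→j ¬j→i =
    chord (≤∧≢⇒< i<j (¬i→j ∘ inj₁)) (Fin.toℕ≤pred[n] j)
          (λ (i≡0 , j≡m) → ¬j→i (inj₂ (cong suc j≡m , i≡0)))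

  chord-of : ∀ {m} (c : IndexedCycle m) → HasChord (toCycle c) → Chord c
  chord-of c (i , j , i≢j , ¬i→j , ¬j→i , ij) with <-cmp (toℕ i) (toℕ j)
  ... | tri< i<j _ _ = chord-between c i j i<j ¬i→j ¬j→i ij
  ... | tri≈ _ i≡j _ = contradiction (Fin.toℕ-injective i≡j) i≢j
  ... | tri> _ _ j<i = chord-between c j i j<i ¬j→i ¬i→j (adj-sym G ij)

  record Reindexing {m} (c : IndexedCycle m) (m′ : ℕ) (φ : ℕ → ℕ) : Set where
    field
      long′      : 2 ≤ m′
      increasing : ∀ {a} → a < m′ → φ a < φ (suc a)
      last≤      : φ m′ ≤ m
      step′      : ∀ {a} → a < m′ → Adj G (at c (φ a)) (at c (φ (suc a)))
      close′     : Adj G (at c (φ m′)) (at c (φ 0))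
  open Reindexing

  module _ {m m′ φ} {c : IndexedCycle m} (r : Reindexing c m′ φ) where

    reindex-≤ : ∀ {a} → a ≤ m′ → φ a ≤ m
    reindex-≤ a≤m′ = ≤-trans (stepwise-monotone φ (increasing r) a≤m′ ≤-refl) (last≤ r)

    reindex : IndexedCycle m′
    reindex = record
      { at           = at c ∘ φ
      ; long         = long′ r
      ; at-injective = λ a≤m′ b≤m′ → stepwise-injective φ (increasing r) a≤m′ b≤m′ ∘
                         at-injective c (reindex-≤ a≤m′) (reindex-≤ b≤m′)
      ; step         = step′ r
      ; close        = close′ r
      }

  segment : ∀ {m m′ x y} (c : IndexedCycle m) → 2 ≤ m′ → m′ + x ≡ y → y ≤ m →
            Adj G (at c x) (at c y) → Reindexing c m′ (_+ x)
  segment {x = x} c 2≤m′ refl y≤m xy = record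
    { long′      = 2≤m′
    ; increasing = λ _ → n<1+n _
    ; last≤      = y≤m
    ; step′      = λ a<m′ → step c (<-≤-trans (+-monoˡ-< x a<m′) y≤m)
    ; close′     = adj-sym G xy
    }

  skip : ∀ {m m′ x k y} (c : IndexedCycle m) → 2 ≤ m′ → x < m′ → suc x + k ≡ y → m′ + k ≡ m →
         Adj G (at c x) (at c y) → Reindexing c m′ (skipAfter x k)
  skip {m′ = m′} {x} {k} c 2≤m′ x<m′ refl refl xy = record
    { long′      = 2≤m′
    ; increasing = increasing′
    ; last≤      = ≤-reflexive φm′≡m
    ; step′      = step″
    ; close′     = subst₂ (λ a b → Adj G (at c a) (at c b))
                     (sym φm′≡m) (sym (skipAfter-≤ {x} k z≤n)) (close c)
    }
    where
    φ : ℕ → ℕ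
    φ = skipAfter x k

    φm′≡m : φ m′ ≡ m′ + k
    φm′≡m = skipAfter-> k x<m′

    increasing′ : ∀ {a} → a < m′ → φ a < φ (suc a)
    increasing′ {a} _ with a ≟ x
    ... | yes refl = subst₂ _<_ (sym (skipAfter-≤ k ≤-refl)) (sym (skipAfter-> k ≤-refl))
                       (s≤s (m≤m+n x k))
    ... | no  a≢x  = subst (φ a <_) (sym (skipAfter-suc k a≢x)) ≤-refl

    step″ : ∀ {a} → a < m′ → Adj G (at c (φ a)) (at c (φ (suc a)))
    step″ {a} a<m′ with a ≟ x
    ... | yes refl = subst₂ (λ a b → Adj G (at c a) (at c b))
                       (sym (skipAfter-≤ k ≤-refl)) (sym (skipAfter-> k ≤-refl)) xy
    ... | no  a≢x  = subst (Adj G (at c (φ a)) ∘ at c) (sym (skipAfter-suc k a≢x))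
                       (step c (≤-<-trans (skipAfter≤+ x k a) (+-monoˡ-< k a<m′)))

  record SubcycleThrough {m} (c : IndexedCycle m) (p : ℕ) : Set where
    field
      {m′}       : ℕ
      {φ}        : ℕ → ℕ
      shorter    : m′ < m
      reindexing : Reindexing c m′ φ
      p′         : ℕ
      p′≤m′      : p′ ≤ m′
      φp′≡p      : φ p′ ≡ p

  TriangleAt : ∀ {m} → IndexedCycle m → ℕ → Set
  TriangleAt {m} c p = ∃₂ λ a b → a ≤ m × b ≤ m × IsTriangle (at c p) (at c a) (at c b)

  triangleAt-reindex : ∀ {m m′ φ p′} {c : IndexedCycle m} (r : Reindexing c m′ φ) →
                       TriangleAt (reindex r) p′ → TriangleAt c (φ p′)
  triangleAt-reindex r (_ , _ , a≤m′ , b≤m′ , abc) =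
    _ , _ , reindex-≤ r a≤m′ , reindex-≤ r b≤m′ , abc

  -- The chord joins x to y = x + 2 + d, and the last position is y + e. The inner cycle runs
  -- along x, …, y; the outer one skips the positions strictly between x and y.
  module SplitAtChord {x d e} (c : IndexedCycle (suc (suc (x + d)) + e)) (0<x+e : 0 < x + e)
                      (chord-adj : Adj G (at c x) (at c (suc (suc (x + d))))) where

    inner : Reindexing c (suc (suc d)) (_+ x)
    inner = segment c (s≤s (s≤s z≤n)) (cong (suc ∘ suc) (+-comm d x)) (m≤m+n _ e) chord-adj

    inner-shorter : suc (suc d) < suc (suc (x + d)) + e
    inner-shorter = subst (suc (suc d) <_) ([2+d]+[x+e]≡[2+x+d]+e x d e) (m<m+n _ 0<x+e)

    y≡x+[2+d] : suc (suc (x + d)) ≡ x + suc (suc d)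
    y≡x+[2+d] = sym (trans (+-suc x (suc d)) (cong suc (+-suc x d)))

    outer : Reindexing c (suc (x + e)) (skipAfter x (suc d))
    outer = skip c (s≤s 0<x+e) (s≤s (m≤m+n x e)) (cong suc (+-suc x d))
              ([1+x+r]+[1+d]≡[2+x+d]+r x d e) chord-adj

    outer-shorter : suc (x + e) < suc (suc (x + d)) + e
    outer-shorter = subst (suc (x + e) <_) ([1+x+r]+[1+d]≡[2+x+d]+r x d e) (m<m+n _ (s≤s z≤n))

    through : ∀ {p} → p ≤ suc (suc (x + d)) + e → SubcycleThrough c p
    through {p} p≤m with p ≤? x | p ≤? suc (suc (x + d))
    ... | yes p≤x | _ = record
      { shorter = outer-shorter ; reindexing = outer ; p′ = p
      ; p′≤m′ = ≤-trans p≤x (≤-trans (m≤m+n x e) (n≤1+n _)) ; φp′≡p = skipAfter-≤ (suc d) p≤x }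
    ... | no p≰x | yes p≤y with m≤n⇒∃[o]m+o≡n (≰⇒≥ p≰x)
    ...   | r , refl = record
      { shorter = inner-shorter ; reindexing = inner ; p′ = r
      ; p′≤m′ = +-cancelˡ-≤ x r _ (subst (x + r ≤_) y≡x+[2+d] p≤y)
      ; φp′≡p = +-comm r x }
    through {p} p≤m | no _ | no p≰y with m≤n⇒∃[o]m+o≡n (<⇒≤ (≰⇒> p≰y))
    ...   | r , refl = record
      { shorter = outer-shorter ; reindexing = outer ; p′ = suc (x + r)
      ; p′≤m′ = s≤s (+-monoʳ-≤ x (+-cancelˡ-≤ _ r e p≤m))
      ; φp′≡p = trans (skipAfter-> (suc d) (s≤s (m≤m+n x r))) ([1+x+r]+[1+d]≡[2+x+d]+r x d r) }

  chord⇒subcycle : ∀ {m p} (c : IndexedCycle m) → p ≤ m → Chord c → SubcycleThrough c p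
  chord⇒subcycle c p≤m (chord {x} gap y≤m not-closing xy) with m≤n⇒∃[o]m+o≡n gap
  ... | d , refl with m≤n⇒∃[o]m+o≡n y≤m
  ...   | e , refl = SplitAtChord.through c (0<x+e x e not-closing) xy p≤m

  triangleAt-3-cycle : (c : IndexedCycle 2) → ∀ {p} → p ≤ 2 → TriangleAt c p
  triangleAt-3-cycle c {0} _ = 1 , 2 , s≤s z≤n , ≤-refl , step c (s≤s z≤n) , step c ≤-refl , close c
  triangleAt-3-cycle c {1} _ = 2 , 0 , ≤-refl , z≤n , step c ≤-refl , close c , step c (s≤s z≤n)
  triangleAt-3-cycle c {2} _ = 0 , 1 , z≤n , s≤s z≤n , close c , step c (s≤s z≤n) , step c ≤-refl
  triangleAt-3-cycle c {suc (suc (suc _))} (s≤s (s≤s ()))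

  chordal-triangleAt : Chordal G → ∀ m (c : IndexedCycle m) {p} → p ≤ m → TriangleAt c p
  chordal-triangleAt chordal = <-rec P go
    where
    P : ℕ → Set
    P m = (c : IndexedCycle m) {p : ℕ} → p ≤ m → TriangleAt c p

    go : ∀ m → (∀ {m′} → m′ < m → P m′) → P m
    go 0 _ c _   = contradiction (long c) λ ()
    go 1 _ c _   = contradiction (long c) λ { (s≤s ()) }
    go 2 _ c p≤2 = triangleAt-3-cycle c p≤2
    go (suc (suc (suc _))) ih c p≤m =
      subst (TriangleAt c) φp′≡p
        (triangleAt-reindex reindexing (ih shorter (reindex reindexing) p′≤m′))
      where
      has-chord : HasChord (toCycle c)
      has-chord = chordal (toCycle c) (s≤s (s≤s (s≤s (s≤s z≤n))))

      open SubcycleThrough (chord⇒subcycle c p≤m (chord-of c has-chord))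

  toIndexedCycle : ∀ {m} (f : Fin (suc m) → Fin n) → 2 ≤ m → Injective _≡_ _≡_ f →
         (∀ i j → Consecutive (suc m) i j → Adj G (f i) (f j)) → IndexedCycle m
  toIndexedCycle {m} f 2≤m f-inj f-edges = record
    { at           = f ∘ (_mod suc m)
    ; long         = 2≤m
    ; at-injective = λ a≤m b≤m eq →
                       trans (sym (toℕ-mod a≤m)) (trans (cong toℕ (f-inj eq)) (toℕ-mod b≤m))
    ; step         = λ a<m → f-edges _ _
                       (inj₁ (trans (cong suc (toℕ-mod (<⇒≤ a<m))) (sym (toℕ-mod a<m))))
    ; close        = f-edges _ _ (inj₂ (cong suc (toℕ-mod ≤-refl) , toℕ-mod {m = m} z≤n))
    }

  chordal-cycle-triangle : Chordal G → (C : Cycle G) (i : Fin (len C)) →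
                           ∃₂ λ j k → IsTriangle (vert C i) (vert C j) (vert C k)
  chordal-cycle-triangle chordal
    record { len = suc m ; len≥3 = s≤s 2≤m ; vert = f ; distinct = f-inj ; edges = f-edges } i
    with chordal-triangleAt chordal m (toIndexedCycle f 2≤m f-inj f-edges) (Fin.toℕ≤pred[n] i)
  ... | a , b , _ , _ , abc =
    a mod suc m , b mod suc m ,
    subst (λ u → IsTriangle (f u) _ _) (Fin.toℕ-injective (toℕ-mod (Fin.toℕ≤pred[n] i))) abc

  triangle-cycle : ∀ {a b c} → IsTriangle a b c → IndexedCycle 2
  triangle-cycle {a} {b} {c} (ab , bc , ca) = record
    { at = corner ; long = ≤-refl ; at-injective = corner-injective ; step = side ; close = ca }
    where
    corner : ℕ → Fin n
    corner 0 = a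
    corner 1 = b
    corner _ = c

    corner-injective : ∀ {i j} → i ≤ 2 → j ≤ 2 → corner i ≡ corner j → i ≡ j
    corner-injective {0} {0} _ _ _   = refl
    corner-injective {0} {1} _ _ a≡b = contradiction a≡b (adj⇒≢ ab)
    corner-injective {0} {2} _ _ a≡c = contradiction (sym a≡c) (adj⇒≢ ca)
    corner-injective {1} {0} _ _ b≡a = contradiction (sym b≡a) (adj⇒≢ ab)
    corner-injective {1} {1} _ _ _   = refl
    corner-injective {1} {2} _ _ b≡c = contradiction b≡c (adj⇒≢ bc)
    corner-injective {2} {0} _ _ c≡a = contradiction c≡a (adj⇒≢ ca)
    corner-injective {2} {1} _ _ c≡b = contradiction (sym c≡b) (adj⇒≢ bc)
    corner-injective {2} {2} _ _ _   = refl
    corner-injective {suc (suc (suc _))} (s≤s (s≤s ())) _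
    corner-injective {_} {suc (suc (suc _))} _ (s≤s (s≤s ()))

    side : ∀ {i} → i < 2 → Adj G (corner i) (corner (suc i))
    side {0} _ = ab
    side {1} _ = bc
    side {suc (suc _)} (s≤s (s≤s ()))

  triangle-set : ∀ {a b c} → IsTriangle a b c → Triangle G ⁅ a ⨾ b ⨾ c ⁆
  triangle-set {a} {b} {c} (ab , bc , ca) =
    ∣⁅x⨾y⨾z⁆∣≡3 (adj⇒≢ ab) (adj⇒≢ ca ∘ sym) (adj⇒≢ bc) ,
    λ u w u∈ w∈ → adjacent (∈⁅x⨾y⨾z⁆⁻ u∈) (∈⁅x⨾y⨾z⁆⁻ w∈)
    where
    adjacent : ∀ {u w} → u ≡ a ⊎ u ≡ b ⊎ u ≡ c → w ≡ a ⊎ w ≡ b ⊎ w ≡ c → u ≢ w → Adj G u w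
    adjacent (inj₁ refl)        (inj₂ (inj₁ refl)) _ = ab
    adjacent (inj₁ refl)        (inj₂ (inj₂ refl)) _ = adj-sym G ca
    adjacent (inj₂ (inj₁ refl)) (inj₁ refl)        _ = adj-sym G ab
    adjacent (inj₂ (inj₁ refl)) (inj₂ (inj₂ refl)) _ = bc
    adjacent (inj₂ (inj₂ refl)) (inj₁ refl)        _ = ca
    adjacent (inj₂ (inj₂ refl)) (inj₂ (inj₁ refl)) _ = adj-sym G bc
    adjacent (inj₁ refl)        (inj₁ refl)        u≢w = contradiction refl u≢w
    adjacent (inj₂ (inj₁ refl)) (inj₂ (inj₁ refl)) u≢w = contradiction refl u≢w
    adjacent (inj₂ (inj₂ refl)) (inj₂ (inj₂ refl)) u≢w = contradiction refl u≢w

module _ {n} (G : Graph n) (T S : Subset n) where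

  no-TTriangle-avoiding : NoTCycleAfterDeleting G T S → ∀ {a b c} → IsTriangle G a b c →
                          a ∈ T → a ∉ S → b ∉ S → c ∉ S → ⊥
  no-TTriangle-avoiding hits abc a∈T a∉S b∉S c∉S =
    hits (toCycle G (triangle-cycle G abc)) (avoids , 0F , a∈T)
    where
    avoids : ∀ i → vert (toCycle G (triangle-cycle G abc)) i ∉ S
    avoids 0F           = a∉S
    avoids (1+ 0F)      = b∉S
    avoids (1+ (1+ 0F)) = c∉S

  module _ (v : Fin n) where

    ExclusiveTTriangle : Fin n → Fin n → Set
    ExclusiveTTriangle b c = IsTriangle G v b c × b ∉ S × c ∉ S × (b ∈ T ⊎ c ∈ T)

    exclusiveTTriangle? : Dec (∃₂ ExclusiveTTriangle)
    exclusiveTTriangle? = Fin.any? λ b → Fin.any? λ c →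
      (adj-dec G v b ×-dec adj-dec G b c ×-dec adj-dec G c v) ×-dec
      ¬? (b ∈? S) ×-dec ¬? (c ∈? S) ×-dec (b ∈? T ⊎-dec c ∈? T)

    exclusive-TTriangle : ∀ {b c} → ExclusiveTTriangle b c → TTriangle G T ⁅ v ⨾ b ⨾ c ⁆
    exclusive-TTriangle {b} {c} (vbc , _ , _ , b∈T⊎c∈T) =
      triangle-set G vbc ,
      [ (λ b∈T → b , y∈⁅x⨾y⨾z⁆ , b∈T) , (λ c∈T → c , z∈⁅x⨾y⨾z⁆ , c∈T) ]′ b∈T⊎c∈T

    exclusive-only-v : ∀ {b c} → ExclusiveTTriangle b c → ∀ u → u ∈ ⁅ v ⨾ b ⨾ c ⁆ → u ∈ S → u ≡ v
    exclusive-only-v (_ , b∉S , c∉S , _) u u∈ u∈S with ∈⁅x⨾y⨾z⁆⁻ u∈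
    ... | inj₁ u≡v         = u≡v
    ... | inj₂ (inj₁ refl) = contradiction u∈S b∉S
    ... | inj₂ (inj₂ refl) = contradiction u∈S c∉S

    -- Minimality only refutes that G − (S − v) has no T-cycle; a witness is recovered because
    -- the existence of an exclusive T-triangle is decidable.
    exclusiveTTriangle-exists : Chordal G → MinimalTCycleHittingSet G T S → v ∈ S → v ∉ T →
                                ∃₂ ExclusiveTTriangle
    exclusiveTTriangle-exists chordal (hits , minimal) v∈S v∉T =
      decidable-stable exclusiveTTriangle? λ none →
        minimal (S - v) (x∈p⇒p-x⊂p v∈S) λ C (avoids , i , t∈T) →
          let j , k , tuw = chordal-cycle-triangle G chordal C i
          in none (from-triangle tuw t∈T (avoids i) (avoids j) (avoids k))
      where
      ∉S : ∀ {x} → x ∉ S - v → x ≢ v → x ∉ S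
      ∉S x∉S-v x≢v x∈S = x∉S-v (x∈p∧x≢y⇒x∈p-y x∈S x≢v)

      T∉S : ∀ {x} → x ∉ S - v → x ∈ T → x ∉ S
      T∉S x∉S-v x∈T = ∉S x∉S-v λ x≡v → v∉T (subst (_∈ T) x≡v x∈T)

      from-triangle : ∀ {t u w} → IsTriangle G t u w → t ∈ T →
                      t ∉ S - v → u ∉ S - v → w ∉ S - v → ∃₂ ExclusiveTTriangle
      from-triangle {t} {u} {w} tuw@(_ , uw , _) t∈T t∉ u∉ w∉ with u Fin.≟ v | w Fin.≟ v
      ... | yes refl | _        =
        w , t , rotate G tuw , ∉S w∉ (adj⇒≢ G uw ∘ sym) , T∉S t∉ t∈T , inj₂ t∈T
      ... | no _     | yes refl =
        t , u , rotate G (rotate G tuw) , T∉S t∉ t∈T , ∉S u∉ (adj⇒≢ G uw) , inj₁ t∈T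
      ... | no u≢v   | no w≢v   =
        ⊥-elim (no-TTriangle-avoiding hits tuw t∈T (T∉S t∉ t∈T) (∉S u∉ u≢v) (∉S w∉ w≢v))

    exclusiveTTriangle-unique :
      NoTCycleAfterDeleting G T S → ∀ {Q} → Clique G Q → (∀ Δ → TTriangle G T Δ → v ∈ Δ → Δ ⊆ Q) →
      ∀ {b c} → ExclusiveTTriangle b c →
      ∀ Δ′ → TTriangle G T Δ′ → v ∈ Δ′ → (∀ u → u ∈ Δ′ → u ∈ S → u ≡ v) → Δ′ ≡ ⁅ v ⨾ b ⨾ c ⁆
    exclusiveTTriangle-unique hits {Q} Q-clique covers {b} {c}
      exclusive@((_ , bc , _) , b∉S , c∉S , b∈T⊎c∈T) Δ′ Δ′-TTriangle v∈Δ′ only-v =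
      p⊆q∧∣q∣≤∣p∣⇒p≡q Δ′⊆Δ (≤-reflexive (trans ∣Δ∣≡3 (sym ∣Δ′∣≡3)))
      where
      Δ : Subset n
      Δ = ⁅ v ⨾ b ⨾ c ⁆

      ∣Δ∣≡3 : ∣ Δ ∣ ≡ 3
      ∣Δ∣≡3 = proj₁ (proj₁ (exclusive-TTriangle exclusive))

      ∣Δ′∣≡3 : ∣ Δ′ ∣ ≡ 3
      ∣Δ′∣≡3 = proj₁ (proj₁ Δ′-TTriangle)

      Δ⊆Q : Δ ⊆ Q
      Δ⊆Q = covers Δ (exclusive-TTriangle exclusive) x∈⁅x⨾y⨾z⁆

      Δ′⊆Q : Δ′ ⊆ Q
      Δ′⊆Q = covers Δ′ Δ′-TTriangle v∈Δ′

      Δ′⊆Δ : Δ′ ⊆ Δ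
      Δ′⊆Δ {x} x∈Δ′ with x ∈? Δ
      ... | yes x∈Δ = x∈Δ
      ... | no  x∉Δ = ⊥-elim ([ (λ b∈T → no-TTriangle-avoiding hits (bc , cx , xb) b∈T b∉S c∉S x∉S)
                              , (λ c∈T → no-TTriangle-avoiding hits (cx , xb , bc) c∈T c∉S x∉S b∉S)
                              ]′ b∈T⊎c∈T)
        where
        x≢ : ∀ {y} → y ∈ Δ → x ≢ y
        x≢ y∈Δ refl = x∉Δ y∈Δ

        x∉S : x ∉ S
        x∉S = x≢ x∈⁅x⨾y⨾z⁆ ∘ only-v x x∈Δ′

        xb : Adj G x b
        xb = Q-clique x b (Δ′⊆Q x∈Δ′) (Δ⊆Q y∈⁅x⨾y⨾z⁆) (x≢ y∈⁅x⨾y⨾z⁆)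

        cx : Adj G c x
        cx = Q-clique c x (Δ⊆Q z∈⁅x⨾y⨾z⁆) (Δ′⊆Q x∈Δ′) (x≢ z∈⁅x⨾y⨾z⁆ ∘ sym)

lemma29 : ∀ {n} (G : Graph n) (T S : Subset n) (v : Fin n) →
    Chordal G →
    MinimalTCycleHittingSet G T S →
    v ∈ S → v ∉ T →
    (∃[ Q ] (Clique G Q × (∀ Δ → TTriangle G T Δ → v ∈ Δ → Δ ⊆ Q))) →
    ∃[ Δ ] ((TTriangle G T Δ × v ∈ Δ × (∀ u → u ∈ Δ → u ∈ S → u ≡ v))
    × (∀ Δ′ → TTriangle G T Δ′ → v ∈ Δ′ → (∀ u → u ∈ Δ′ → u ∈ S → u ≡ v) → Δ′ ≡ Δ))
lemma29 G T S v chordal minimal@(hits , _) v∈S v∉T (Q , Q-clique , covers) =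
  let b , c , exclusive = exclusiveTTriangle-exists G T S v chordal minimal v∈S v∉T
  in ⁅ v ⨾ b ⨾ c ⁆ ,
     (exclusive-TTriangle G T S v exclusive , x∈⁅x⨾y⨾z⁆ , exclusive-only-v G T S v exclusive) ,
     exclusiveTTriangle-unique G T S v hits Q-clique covers exclusive
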